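{- Let $G_1$ and $G_2$ be two connected graphs with $G_1\neq K_1$, and let $f$ be an automorphism of $G_1\star G_2$ such that $f(v_i)=u^k_j$ for some $i,k\in\{1,\dots,n_1\}$ and $j\in\{1,\dots,n_2\}$. Then $d_{G_1}(v_k)>d_{G_1}(v_i)$.
   Context: All graphs are finite and simple; $d_G(v)$ denotes the degree of $v$ in $G$. Let $V(G_1)=\{v_1,\dots,v_{n_1}\}$ and $V(G_2)=\{u_1,\dots,u_{n_2}\}$. The neighbourhood corona $G_1\star G_2$ is obtained by taking one copy of $G_1$ and $n_1$ copies of $G_2$, the $i$th copy having vertices $u^i_1,\dots,u^i_{n_2}$ ($u^i_j$ being the copy of $u_j$), and joining every neighbour (in $G_1$) of $v_i$ to every vertex of the $i$th copy of $G_2$, for each $i$. -}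

module Defs where

open import Level using (0ℓ)
open import Data.Nat using (ℕ)
open import Data.Fin using (Fin)
open import Data.Product using (_×_; _,_)
open import Data.Sum using (_⊎_; inj₁; inj₂)
open import Data.List using (List; length; filter)
open import Data.List.Base using (allFin)
open import Data.Empty using (⊥)
open import Relation.Nullary using (¬_; Dec)
open import Relation.Binary.PropositionalEquality using (_≡_)
open import Relation.Binary.Construct.Closure.ReflexiveTransitive using (Star)
open import Function.Bundles using (_⤖_; _⇔_; Bijection)

record Graph (n : ℕ) : Set₁ where
  field
    Adj   : Fin n → Fin n → Set
    adj?  : ∀ x y → Dec (Adj x y)
    sym   : ∀ {x y} → Adj x y → Adj y x
    irrefl : ∀ x → ¬ Adj x x
open Graph public

degree : ∀ {n} → Graph n → Fin n → ℕ
degree G v = length (filter (adj? G v) (allFin _))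

Connected : ∀ {n} → Graph n → Set
Connected {n} G = ∀ (x y : Fin n) → Star (Adj G) x y

-- Vertex set of the neighbourhood corona G₁ ⋆ G₂:
-- inj₁ i       is the vertex v_i of the copy of G₁,
-- inj₂ (k , j) is the vertex u^k_j (copy of u_j in the k-th copy of G₂).
CVertex : ℕ → ℕ → Set
CVertex n₁ n₂ = Fin n₁ ⊎ (Fin n₁ × Fin n₂)

CAdj : ∀ {n₁ n₂} → Graph n₁ → Graph n₂ → CVertex n₁ n₂ → CVertex n₁ n₂ → Set
CAdj G₁ G₂ (inj₁ a)       (inj₁ b)       = Adj G₁ a b
CAdj G₁ G₂ (inj₁ a)       (inj₂ (k , j)) = Adj G₁ a k
CAdj G₁ G₂ (inj₂ (k , j)) (inj₁ b)       = Adj G₁ k b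
CAdj G₁ G₂ (inj₂ (k , j)) (inj₂ (l , m)) = (k ≡ l) × Adj G₂ j m

record CAut {n₁ n₂} (G₁ : Graph n₁) (G₂ : Graph n₂) : Set where
  field
    bij : CVertex n₁ n₂ ⤖ CVertex n₁ n₂
    preserves : ∀ x y →
      CAdj G₁ G₂ x y ⇔ CAdj G₁ G₂ (Bijection.to bij x) (Bijection.to bij y)

-- The neighbourhood of vᵢ in G₁ ⋆ G₂ consists of the dᵢ vertices v_l with l adjacent to i
-- together with all dᵢ·n₂ vertices of the copies of G₂ indexed by those l, while the
-- neighbourhood of uᵏⱼ has only d_k + d_{G₂}(uⱼ) < d_k + n₂ vertices. An automorphism
-- sending vᵢ to uᵏⱼ injects the first neighbourhood into the second, and since G₁ is
-- connected with at least two vertices, dᵢ ≥ 1, so dᵢ + n₂ ≤ dᵢ + dᵢ·n₂ < d_k + n₂.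
module Submission where

open import Defs hiding (sym)
open import Data.Nat using (_<_; _≤_; _+_; _*_; suc; z≤n; s≤s)
open import Data.Nat.Properties
  using (m<n⇒0<n; +-monoʳ-≤; +-monoʳ-<; *-monoˡ-≤; *-identityˡ; +-cancelʳ-<; module ≤-Reasoning)
open import Data.Fin using (Fin; zero; punchIn)
open import Data.Fin.Properties using (punchInᵢ≢i; toℕ<n)
open import Data.Product using (_,_; _×_; proj₁; proj₂)
open import Data.Sum using (inj₁; inj₂)
open import Data.List using (List; []; _∷_; length; map; filter; _++_; cartesianProduct; allFin)
open import Data.List.Properties using (length-map; length-++; length-tabulate; length-removeAt′; filter-notAll)
open import Data.List.Membership.Propositional using (_∈_)
open import Data.List.Membership.Propositional.Properties
  using (∈-map⁺; ∈-map⁻; ∈-++⁺ˡ; ∈-++⁺ʳ; ∈-++⁻; ∈-filter⁺; ∈-filter⁻; ∈-allFin; ∈-cartesianProduct⁻)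
open import Data.List.Relation.Binary.Subset.Propositional using (_⊆_)
open import Data.List.Relation.Unary.Any using (here; there; _─_)
import Data.List.Relation.Unary.Any as Any
open import Data.List.Relation.Unary.All using (lookup)
open import Data.List.Relation.Unary.AllPairs using (_∷_)
open import Data.List.Relation.Unary.Unique.Propositional using (Unique)
import Data.List.Relation.Unary.Unique.Propositional.Properties as Unique
open import Function using (_∘_; id)
open import Function.Bundles using (Bijection; Equivalence)
open import Relation.Binary.PropositionalEquality using (_≡_; _≢_; refl; sym; cong; cong₂; subst; subst₂; trans; module ≡-Reasoning)
open import Relation.Binary.Construct.Closure.ReflexiveTransitive using (Star; ε; _◅_)
open import Relation.Nullary using (¬_)
open import Data.Empty using (⊥-elim)

private
  variable
    A B : Set

∈-─⁺ : ∀ {x z : A} {ys} (x∈ys : x ∈ ys) → z ∈ ys → z ≢ x → z ∈ (ys ─ x∈ys)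
∈-─⁺ (here refl)   (here refl)   z≢x = ⊥-elim (z≢x refl)
∈-─⁺ (here refl)   (there z∈ys)  _   = z∈ys
∈-─⁺ (there _)     (here refl)   _   = here refl
∈-─⁺ (there x∈ys)  (there z∈ys)  z≢x = there (∈-─⁺ x∈ys z∈ys z≢x)

Unique⇒length-mono-⊆ : {xs ys : List A} → Unique xs → xs ⊆ ys → length xs ≤ length ys
Unique⇒length-mono-⊆ {xs = []} _ _ = z≤n
Unique⇒length-mono-⊆ {xs = x ∷ xs} {ys} (x∉xs ∷ uniq) xs⊆ys =
  subst (suc (length xs) ≤_) (sym (length-removeAt′ ys (Any.index x∈ys)))
    (s≤s (Unique⇒length-mono-⊆ uniq λ z∈xs →
      ∈-─⁺ x∈ys (xs⊆ys (there z∈xs)) (λ z≡x → lookup x∉xs z∈xs (sym z≡x))))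
  where
  x∈ys : x ∈ ys
  x∈ys = xs⊆ys (here refl)

length-cartesianProduct : (xs : List A) (ys : List B) →
  length (cartesianProduct xs ys) ≡ length xs * length ys
length-cartesianProduct []       ys = refl
length-cartesianProduct (x ∷ xs) ys =
  trans (length-++ (map (x ,_) ys))
        (cong₂ _+_ (length-map (x ,_) ys) (length-cartesianProduct xs ys))

length-allFin : ∀ n → length (allFin n) ≡ n
length-allFin n = length-tabulate id

m+m*n≤o+p∧p<n⇒m<o : ∀ {m n o p} → 1 ≤ m → p < n → m + m * n ≤ o + p → m < o
m+m*n≤o+p∧p<n⇒m<o {m} {n} {o} {p} 1≤m p<n m+m*n≤o+p = +-cancelʳ-< n m o (begin-strict
  m + n      ≡⟨ cong (m +_) (sym (*-identityˡ n)) ⟩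
  m + 1 * n  ≤⟨ +-monoʳ-≤ m (*-monoˡ-≤ n 1≤m) ⟩
  m + m * n  ≤⟨ m+m*n≤o+p ⟩
  o + p      <⟨ +-monoʳ-< o p<n ⟩
  o + n      ∎)
  where open ≤-Reasoning

module _ {n} (G : Graph n) where

  neighbours : Fin n → List (Fin n)
  neighbours v = filter (adj? G v) (allFin n)

  ∈-neighbours⁺ : ∀ {v w} → Adj G v w → w ∈ neighbours v
  ∈-neighbours⁺ {v} {w} = ∈-filter⁺ (adj? G v) (∈-allFin w)

  ∈-neighbours⁻ : ∀ {v w} → w ∈ neighbours v → Adj G v w
  ∈-neighbours⁻ {v} w∈ = proj₂ (∈-filter⁻ (adj? G v) {xs = allFin n} w∈)

  neighbours-unique : ∀ v → Unique (neighbours v)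
  neighbours-unique v = Unique.filter⁺ (adj? G v) (Unique.allFin⁺ n)

  degree<order : ∀ v → degree G v < n
  degree<order v = subst (degree G v <_) (length-allFin n)
    (filter-notAll (adj? G v) (allFin n) (Any.map (λ { refl → irrefl G v }) (∈-allFin v)))

  degree-pos-if-walk : ∀ {v w} → Star (Adj G) v w → w ≢ v → 1 ≤ degree G v
  degree-pos-if-walk ε         w≢v = ⊥-elim (w≢v refl)
  degree-pos-if-walk (v~x ◅ _) _ = m<n⇒0<n (toℕ<n (Any.index (∈-neighbours⁺ v~x)))

  Connected⇒degree-pos : Connected G → 2 ≤ n → ∀ v → 1 ≤ degree G v
  Connected⇒degree-pos conn (s≤s (s≤s _)) v =
    degree-pos-if-walk (conn v (punchIn v zero)) (punchInᵢ≢i v zero)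

module _ {n₁ n₂} (G₁ : Graph n₁) (G₂ : Graph n₂) where

  private
    V : Set
    V = CVertex n₁ n₂

    _~_ : V → V → Set
    _~_ = CAdj G₁ G₂

  base-neighbours : Fin n₁ → List V
  base-neighbours i =
    map inj₁ (neighbours G₁ i) ++ map inj₂ (cartesianProduct (neighbours G₁ i) (allFin n₂))

  copy-neighbours : Fin n₁ → Fin n₂ → List V
  copy-neighbours k j = map inj₁ (neighbours G₁ k) ++ map (inj₂ ∘ (k ,_)) (neighbours G₂ j)

  base-neighbours-unique : ∀ i → Unique (base-neighbours i)
  base-neighbours-unique i = Unique.++⁺
    (Unique.map⁺ (λ { refl → refl }) (neighbours-unique G₁ i))
    (Unique.map⁺ (λ { refl → refl })
      (Unique.cartesianProduct⁺ (neighbours-unique G₁ i) (Unique.allFin⁺ n₂)))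
    inj₁≢inj₂
    where
    inj₁≢inj₂ : ∀ {x} → ¬ (x ∈ map inj₁ (neighbours G₁ i) ×
                           x ∈ map inj₂ (cartesianProduct (neighbours G₁ i) (allFin n₂)))
    inj₁≢inj₂ (x∈₁ , x∈₂) with ∈-map⁻ inj₁ x∈₁ | ∈-map⁻ inj₂ x∈₂
    ... | _ , _ , refl | _ , _ , ()

  base-neighbours-adjacent : ∀ {i x} → x ∈ base-neighbours i → inj₁ i ~ x
  base-neighbours-adjacent {i} x∈ with ∈-++⁻ (map inj₁ (neighbours G₁ i)) x∈
  ... | inj₁ x∈₁ with ∈-map⁻ inj₁ x∈₁
  ...   | _ , l∈ , refl = ∈-neighbours⁻ G₁ l∈
  base-neighbours-adjacent {i} _ | inj₂ x∈₂ with ∈-map⁻ inj₂ x∈₂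
  ...   | _ , lm∈ , refl =
    ∈-neighbours⁻ G₁ (proj₁ (∈-cartesianProduct⁻ (neighbours G₁ i) (allFin n₂) lm∈))

  copy-neighbours-complete : ∀ {k j} x → inj₂ (k , j) ~ x → x ∈ copy-neighbours k j
  copy-neighbours-complete (inj₁ l) k~l = ∈-++⁺ˡ (∈-map⁺ inj₁ (∈-neighbours⁺ G₁ k~l))
  copy-neighbours-complete {k} (inj₂ (_ , m)) (refl , j~m) =
    ∈-++⁺ʳ (map inj₁ (neighbours G₁ k)) (∈-map⁺ (inj₂ ∘ (k ,_)) (∈-neighbours⁺ G₂ j~m))

  length-base-neighbours : ∀ i → length (base-neighbours i) ≡ degree G₁ i + degree G₁ i * n₂
  length-base-neighbours i = begin
    length (base-neighbours i)
      ≡⟨ length-++ (map inj₁ Nᵢ) ⟩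
    length (map inj₁ Nᵢ) + length (map inj₂ (cartesianProduct Nᵢ (allFin n₂)))
      ≡⟨ cong₂ _+_ (length-map inj₁ Nᵢ) (length-map inj₂ (cartesianProduct Nᵢ (allFin n₂))) ⟩
    length Nᵢ + length (cartesianProduct Nᵢ (allFin n₂))
      ≡⟨ cong (length Nᵢ +_) (length-cartesianProduct Nᵢ (allFin n₂)) ⟩
    length Nᵢ + length Nᵢ * length (allFin n₂)
      ≡⟨ cong (λ m → length Nᵢ + length Nᵢ * m) (length-allFin n₂) ⟩
    degree G₁ i + degree G₁ i * n₂ ∎
    where
    open ≡-Reasoning
    Nᵢ = neighbours G₁ i

  length-copy-neighbours : ∀ k j → length (copy-neighbours k j) ≡ degree G₁ k + degree G₂ j
  length-copy-neighbours k j = trans (length-++ (map inj₁ (neighbours G₁ k)))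
    (cong₂ _+_ (length-map inj₁ (neighbours G₁ k)) (length-map (inj₂ ∘ (k ,_)) (neighbours G₂ j)))

  CAut-length-neighbours-≤ : (f : CAut G₁ G₂) {x : V} {xs ys : List V} →
    Unique xs → (∀ {y} → y ∈ xs → x ~ y) →
    (∀ z → Bijection.to (CAut.bij f) x ~ z → z ∈ ys) →
    length xs ≤ length ys
  CAut-length-neighbours-≤ f {x} {xs} {ys} uniq x~xs ys-complete =
    subst (_≤ length ys) (length-map f⟨_⟩ xs)
      (Unique⇒length-mono-⊆ (Unique.map⁺ (Bijection.injective (CAut.bij f)) uniq) f[xs]⊆ys)
    where
    f⟨_⟩ : V → V
    f⟨_⟩ = Bijection.to (CAut.bij f)

    f[xs]⊆ys : map f⟨_⟩ xs ⊆ ys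
    f[xs]⊆ys z∈ with ∈-map⁻ f⟨_⟩ z∈
    ... | y , y∈xs , refl =
      ys-complete f⟨ y ⟩ (Equivalence.to (CAut.preserves f x y) (x~xs y∈xs))

lemma2p1 : ∀ {n₁ n₂} (G₁ : Graph n₁) (G₂ : Graph n₂) →
    Connected G₁ → Connected G₂ → 2 ≤ n₁ →
    (f : CAut G₁ G₂) (i k : Fin n₁) (j : Fin n₂) →
    Bijection.to (CAut.bij f) (inj₁ i) ≡ inj₂ (k , j) →
    degree G₁ i < degree G₁ k
lemma2p1 G₁ G₂ connected₁ _ 2≤n₁ f i k j f[vᵢ]≡uᵏⱼ =
  m+m*n≤o+p∧p<n⇒m<o (Connected⇒degree-pos G₁ connected₁ 2≤n₁ i) (degree<order G₂ j)
    (subst₂ _≤_ (length-base-neighbours G₁ G₂ i) (length-copy-neighbours G₁ G₂ k j)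
      (CAut-length-neighbours-≤ G₁ G₂ f (base-neighbours-unique G₁ G₂ i)
        (base-neighbours-adjacent G₁ G₂) N[f⟨vᵢ⟩]⊆copy-neighbours))
  where
  N[f⟨vᵢ⟩]⊆copy-neighbours : ∀ z → CAdj G₁ G₂ (Bijection.to (CAut.bij f) (inj₁ i)) z →
                            z ∈ copy-neighbours G₁ G₂ k j
  N[f⟨vᵢ⟩]⊆copy-neighbours z rewrite f[vᵢ]≡uᵏⱼ = copy-neighbours-complete G₁ G₂ z
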